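{- Let $n$ and $d$ be even positive integers and let $k$ be an odd positive integer. Let $Q(\mathbb{Z}_n^{[d]})$ be the $d$-dimensional latin hypercube of order $n$ whose cells are indexed by $(x_1,\ldots,x_d)\in\mathbb{Z}_n^d$ and whose entry in cell $(x_1,\ldots,x_d)$ is the unique $x_0\in\mathbb{Z}_n$ with $x_0+x_1+\cdots+x_d=0$ in $\mathbb{Z}_n$ (the Cayley table of the $d$-iterated cyclic group $\mathbb{Z}_n$). Then $Q(\mathbb{Z}_n^{[d]})$ has no $k$-multiplex.
   Context: A hyperplane of a $d$-dimensional array of order $n$ is the set of cells obtained by fixing one of the $d$ coordinates to a given value. A $k$-multiplex in a $d$-dimensional latin hypercube $Q$ of order $n$ (an array filled with $n$ symbols, each symbol occurring once in every line) is a multiset of $kn$ cells of $Q$ such that every hyperplane contains exactly $k$ of them (counted with multiplicity) and every symbol occurs in exactly $k$ of them (counted with multiplicity). -}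

module Defs where

open import Data.Nat using (ℕ; zero; suc; _+_; _*_; _∸_; _%_; NonZero)
open import Data.Nat.DivMod using (m%n<n)
open import Data.Fin using (Fin; toℕ; fromℕ<; _≟_)
open import Data.Vec.Functional using (_∷_)
open import Relation.Nullary using (does)
open import Data.Bool using (if_then_else_)
open import Relation.Binary.PropositionalEquality using (_≡_)

Cell : ℕ → ℕ → Set
Cell d n = Fin d → Fin n

Array : ℕ → ℕ → Set
Array d n = Cell d n → Fin n

sumFin : (n : ℕ) → (Fin n → ℕ) → ℕ
sumFin zero    f = 0
sumFin (suc n) f = f Fin.zero + sumFin n (λ i → f (Fin.suc i))


sumCells : (d n : ℕ) → (Cell d n → ℕ) → ℕ
sumCells zero    n f = f (λ ())
sumCells (suc d) n f = sumFin n (λ a → sumCells d n (λ c → f (a ∷ c)))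

Multiset : ℕ → ℕ → Set
Multiset d n = Cell d n → ℕ

countWhere : {d n : ℕ} → Multiset d n → (Cell d n → Fin n) → Fin n → ℕ
countWhere {d} {n} m g b =
  sumCells d n (λ c → if does (g c ≟ b) then m c else 0)

-- k-multiplex in the array Q: a multiset of k·n cells such that every
-- hyperplane (coordinate i fixed to value a) contains exactly k of them and
-- every symbol s occurs in exactly k of them (all with multiplicity).
IsMultiplex : {d n : ℕ} → Array d n → ℕ → Multiset d n → Set
IsMultiplex {d} {n} Q k m =
  (sumCells d n m ≡ k * n)
  × ((i : Fin d) (a : Fin n) → countWhere m (λ c → c i) a ≡ k)
  × ((s : Fin n) → countWhere m Q s ≡ k)
  where open import Data.Product using (_×_)

coordSum : {d n : ℕ} → Cell d n → ℕ
coordSum {d} c = sumFin d (λ i → toℕ (c i))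

-- Q(ℤ_n^[d]): the entry of cell (x₁,…,x_d) is the unique x₀ ∈ ℤ_n with
-- x₀ + x₁ + ⋯ + x_d ≡ 0 (mod n), i.e. x₀ = (n ∸ (Σ xᵢ mod n)) mod n.
iteratedCyclic : (d n : ℕ) → .{{NonZero n}} → Array d n
iteratedCyclic d n c = fromℕ< (m%n<n (n ∸ (coordSum c % n)) n)

-- Weight each cell c = (x₁,…,x_d) of a k-multiplex by its multiplicity and add up the
-- integer x₀ + x₁ + ⋯ + x_d, where x₀ is the symbol in c. Every term is divisible by n.
-- On the other hand each of the d + 1 coordinates takes every value a ∈ ℤ_n with total
-- weight exactly k, so the sum equals (d + 1) k (0 + 1 + ⋯ + (n − 1)) = (d + 1) k n(n − 1)/2.
-- For n = 2h this is divisible by 2h only if (d + 1) k (2h − 1) is even, which fails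
-- since d is even and k is odd.
module Submission where

open import Defs
open import Data.Nat using (ℕ; NonZero; _<_)
open import Data.Nat.Divisibility using (_∣_)
open import Data.Product using (Σ)
open import Relation.Nullary using (¬_)

open import Data.Bool using (Bool; true; false; if_then_else_)
open import Data.Fin using (Fin; toℕ; _≟_)
open import Data.Fin.Properties using (toℕ-fromℕ<)
open import Data.Nat using (zero; suc; _+_; _*_; _∸_; _/_; _%_; ≢-nonZero⁻¹)
open import Data.Nat.Properties using (+-comm; +-assoc; +-identityʳ; *-comm; *-identityʳ; *-zeroʳ; *-distribˡ-+; m∸n+n≡m)
open import Data.Nat.Divisibility
  using (divides; ∣m∣n⇒∣m+n; ∣m+n∣m⇒∣n; ∣1⇒≡1; ∣-trans; n∣m*n; *-cancelˡ-∣)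
open import Data.Nat.DivMod using (m≡m%n+[m/n]*n; m%n<n; m%n≤n)
open import Data.Nat.Primality using (prime?; euclidsLemma)
open import Data.Nat.Tactic.RingSolver using (solve-∀)
open import Data.Product using (_,_)
open import Data.Sum using (inj₁; inj₂)
open import Data.Vec.Functional using (_∷_)
open import Relation.Nullary using (does)
open import Relation.Nullary.Decidable using (from-yes)
open import Relation.Binary.PropositionalEquality
  using (_≡_; refl; sym; trans; cong; cong₂; subst; module ≡-Reasoning)

open ≡-Reasoning

sumFin-cong : ∀ n {f g : Fin n → ℕ} → (∀ i → f i ≡ g i) → sumFin n f ≡ sumFin n g
sumFin-cong zero    f≗g = refl
sumFin-cong (suc n) f≗g = cong₂ _+_ (f≗g Fin.zero) (sumFin-cong n (λ i → f≗g (Fin.suc i)))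

sumFin-+ : ∀ n (f g : Fin n → ℕ) → sumFin n (λ i → f i + g i) ≡ sumFin n f + sumFin n g
sumFin-+ zero    f g = refl
sumFin-+ (suc n) f g =
  trans (cong (f Fin.zero + g Fin.zero +_) (sumFin-+ n _ _)) (medial (f Fin.zero) (g Fin.zero) _ _)
  where
  medial : ∀ a b c e → a + b + (c + e) ≡ a + c + (b + e)
  medial = solve-∀

sumFin-* : ∀ n a (f : Fin n → ℕ) → sumFin n (λ i → a * f i) ≡ a * sumFin n f
sumFin-* zero    a f = sym (*-zeroʳ a)
sumFin-* (suc n) a f =
  trans (cong (a * f Fin.zero +_) (sumFin-* n a _)) (sym (*-distribˡ-+ a _ _))

sumFin-const : ∀ n x → sumFin n (λ _ → x) ≡ n * x
sumFin-const zero    x = refl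
sumFin-const (suc n) x = cong (x +_) (sumFin-const n x)

sumFin-comm : ∀ m n (f : Fin m → Fin n → ℕ) →
  sumFin m (λ i → sumFin n (f i)) ≡ sumFin n (λ j → sumFin m (λ i → f i j))
sumFin-comm zero    n f = sym (trans (sumFin-const n 0) (*-zeroʳ n))
sumFin-comm (suc m) n f =
  trans (cong (sumFin n (f Fin.zero) +_) (sumFin-comm m n _)) (sym (sumFin-+ n _ _))

sumFin-∣ : ∀ n {q} (f : Fin n → ℕ) → (∀ i → q ∣ f i) → q ∣ sumFin n f
sumFin-∣ zero    f q∣f = divides 0 refl
sumFin-∣ (suc n) f q∣f = ∣m∣n⇒∣m+n (q∣f Fin.zero) (sumFin-∣ n _ (λ i → q∣f (Fin.suc i)))

sumFin-select : ∀ n (b : Fin n) (f : Fin n → ℕ) →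
  sumFin n (λ a → if does (b ≟ a) then f a else 0) ≡ f b
sumFin-select (suc n) Fin.zero    f =
  trans (cong (f Fin.zero +_) (trans (sumFin-const n 0) (*-zeroʳ n))) (+-identityʳ _)
sumFin-select (suc n) (Fin.suc b) f = sumFin-select n b (λ a → f (Fin.suc a))

sumCells-cong : ∀ d n {f g : Cell d n → ℕ} → (∀ c → f c ≡ g c) → sumCells d n f ≡ sumCells d n g
sumCells-cong zero    n f≗g = f≗g _
sumCells-cong (suc d) n f≗g = sumFin-cong n (λ a → sumCells-cong d n (λ c → f≗g (a ∷ c)))

sumCells-+ : ∀ d n (f g : Cell d n → ℕ) →
  sumCells d n (λ c → f c + g c) ≡ sumCells d n f + sumCells d n g
sumCells-+ zero    n f g = refl
sumCells-+ (suc d) n f g = trans (sumFin-cong n (λ a → sumCells-+ d n _ _)) (sumFin-+ n _ _)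

sumCells-* : ∀ d n a (f : Cell d n → ℕ) → sumCells d n (λ c → a * f c) ≡ a * sumCells d n f
sumCells-* zero    n a f = refl
sumCells-* (suc d) n a f = trans (sumFin-cong n (λ b → sumCells-* d n a _)) (sumFin-* n a _)

sumCells-sumFin-comm : ∀ d n p (f : Cell d n → Fin p → ℕ) →
  sumCells d n (λ c → sumFin p (f c)) ≡ sumFin p (λ j → sumCells d n (λ c → f c j))
sumCells-sumFin-comm zero    n p f = refl
sumCells-sumFin-comm (suc d) n p f =
  trans (sumFin-cong n (λ a → sumCells-sumFin-comm d n p _)) (sumFin-comm n p _)

sumCells-∣ : ∀ d n {q} (f : Cell d n → ℕ) → (∀ c → q ∣ f c) → q ∣ sumCells d n f
sumCells-∣ zero    n f q∣f = q∣f _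
sumCells-∣ (suc d) n f q∣f = sumFin-∣ n _ (λ a → sumCells-∣ d n _ (λ c → q∣f (a ∷ c)))

*-if-else-0 : ∀ (b : Bool) x y → (if b then x * y else 0) ≡ x * (if b then y else 0)
*-if-else-0 true  x y = refl
*-if-else-0 false x y = sym (*-zeroʳ x)

sumCells-*-countWhere : ∀ {d n} (m : Multiset d n) (g : Cell d n → Fin n) (w : Fin n → ℕ) →
  sumCells d n (λ c → m c * w (g c)) ≡ sumFin n (λ a → w a * countWhere m g a)
sumCells-*-countWhere {d} {n} m g w = begin
  sumCells d n (λ c → m c * w (g c))
    ≡⟨ sumCells-cong d n (λ c → trans (*-comm (m c) _) (sym (sumFin-select n (g c) _))) ⟩
  sumCells d n (λ c → sumFin n (λ a → if does (g c ≟ a) then w a * m c else 0))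
    ≡⟨ sumCells-sumFin-comm d n n _ ⟩
  sumFin n (λ a → sumCells d n (λ c → if does (g c ≟ a) then w a * m c else 0))
    ≡⟨ sumFin-cong n (λ a → sumCells-cong d n (λ c → *-if-else-0 (does (g c ≟ a)) (w a) (m c))) ⟩
  sumFin n (λ a → sumCells d n (λ c → w a * (if does (g c ≟ a) then m c else 0)))
    ≡⟨ sumFin-cong n (λ a → sumCells-* d n (w a) _) ⟩
  sumFin n (λ a → w a * countWhere m g a) ∎

triangle : ℕ → ℕ
triangle n = sumFin n toℕ

triangle-suc : ∀ n → triangle (suc n) ≡ n + triangle n
triangle-suc n = begin
  sumFin n (λ i → 1 + toℕ i)      ≡⟨ sumFin-+ n (λ _ → 1) toℕ ⟩
  sumFin n (λ _ → 1) + triangle n ≡⟨ cong (_+ triangle n) (trans (sumFin-const n 1) (*-identityʳ n)) ⟩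
  n + triangle n                  ∎

triangle-even : ∀ h → triangle (suc h * 2) ≡ suc h * suc (h * 2)
triangle-even zero    = refl
triangle-even (suc h) = begin
  triangle (suc (suc (suc h * 2)))
    ≡⟨ triangle-suc (suc (suc h * 2)) ⟩
  suc (suc h * 2) + triangle (suc (suc h * 2))
    ≡⟨ cong (suc (suc h * 2) +_) (triangle-suc (suc h * 2)) ⟩
  suc (suc h * 2) + (suc h * 2 + triangle (suc h * 2))
    ≡⟨ cong (λ t → suc (suc h * 2) + (suc h * 2 + t)) (triangle-even h) ⟩
  suc (suc h * 2) + (suc h * 2 + suc h * suc (h * 2))
    ≡⟨ expand h ⟩
  suc (suc h) * suc (suc h * 2) ∎
  where
  expand : ∀ h → suc (suc h * 2) + (suc h * 2 + suc h * suc (h * 2)) ≡ suc (suc h) * suc (suc h * 2)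
  expand = solve-∀

balanced-sumCells-*-toℕ : ∀ {d n k} (m : Multiset d n) (g : Cell d n → Fin n) →
  (∀ a → countWhere m g a ≡ k) → sumCells d n (λ c → m c * toℕ (g c)) ≡ k * triangle n
balanced-sumCells-*-toℕ {d} {n} {k} m g balanced = begin
  sumCells d n (λ c → m c * toℕ (g c))     ≡⟨ sumCells-*-countWhere m g toℕ ⟩
  sumFin n (λ a → toℕ a * countWhere m g a) ≡⟨ sumFin-cong n (λ a → cong (toℕ a *_) (balanced a)) ⟩
  sumFin n (λ a → toℕ a * k)               ≡⟨ sumFin-cong n (λ a → *-comm (toℕ a) k) ⟩
  sumFin n (λ a → k * toℕ a)               ≡⟨ sumFin-* n k toℕ ⟩
  k * triangle n                           ∎

multiplex-sumCells-*-entry+coordSum : ∀ {d n k} (Q : Array d n) (m : Multiset d n) →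
  IsMultiplex Q k m →
  sumCells d n (λ c → m c * (toℕ (Q c) + coordSum c)) ≡ suc d * k * triangle n
multiplex-sumCells-*-entry+coordSum {d} {n} {k} Q m (_ , hyperplanes , symbols) = begin
  sumCells d n (λ c → m c * (toℕ (Q c) + coordSum c))
    ≡⟨ sumCells-cong d n (λ c → *-distribˡ-+ (m c) _ _) ⟩
  sumCells d n (λ c → m c * toℕ (Q c) + m c * coordSum c)
    ≡⟨ sumCells-+ d n _ _ ⟩
  sumCells d n (λ c → m c * toℕ (Q c)) + sumCells d n (λ c → m c * coordSum c)
    ≡⟨ cong₂ _+_ (balanced-sumCells-*-toℕ m Q symbols) coordinates ⟩
  k * triangle n + d * (k * triangle n)
    ≡⟨ regroup d k (triangle n) ⟩
  suc d * k * triangle n ∎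
  where
  coordinates : sumCells d n (λ c → m c * coordSum c) ≡ d * (k * triangle n)
  coordinates = begin
    sumCells d n (λ c → m c * coordSum c)
      ≡⟨ sumCells-cong d n (λ c → sym (sumFin-* d (m c) (λ i → toℕ (c i)))) ⟩
    sumCells d n (λ c → sumFin d (λ i → m c * toℕ (c i)))
      ≡⟨ sumCells-sumFin-comm d n d _ ⟩
    sumFin d (λ i → sumCells d n (λ c → m c * toℕ (c i)))
      ≡⟨ sumFin-cong d (λ i → balanced-sumCells-*-toℕ m (λ c → c i) (hyperplanes i)) ⟩
    sumFin d (λ _ → k * triangle n)
      ≡⟨ sumFin-const d _ ⟩
    d * (k * triangle n) ∎
  regroup : ∀ d k t → k * t + d * (k * t) ≡ suc d * k * t
  regroup = solve-∀

n∣m+o⇒n∣m%n+o : ∀ {n} .{{_ : NonZero n}} m o → n ∣ m + o → n ∣ m % n + o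
n∣m+o⇒n∣m%n+o {n} m o n∣m+o = ∣m+n∣m⇒∣n (subst (n ∣_) split n∣m+o) (n∣m*n (m / n))
  where
  split : m + o ≡ m / n * n + (m % n + o)
  split = begin
    m + o                     ≡⟨ cong (_+ o) (m≡m%n+[m/n]*n m n) ⟩
    m % n + m / n * n + o     ≡⟨ cong (_+ o) (+-comm (m % n) _) ⟩
    m / n * n + m % n + o     ≡⟨ +-assoc (m / n * n) _ _ ⟩
    m / n * n + (m % n + o)   ∎

n∣[n∸m%n]+m : ∀ n .{{_ : NonZero n}} m → n ∣ (n ∸ m % n) + m
n∣[n∸m%n]+m n m = divides (suc (m / n)) (begin
  n ∸ m % n + m                   ≡⟨ cong (n ∸ m % n +_) (m≡m%n+[m/n]*n m n) ⟩
  n ∸ m % n + (m % n + m / n * n) ≡⟨ sym (+-assoc (n ∸ m % n) _ _) ⟩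
  n ∸ m % n + m % n + m / n * n   ≡⟨ cong (_+ m / n * n) (m∸n+n≡m (m%n≤n m n)) ⟩
  n + m / n * n                   ∎)

iteratedCyclic-∣-entry+coordSum : ∀ d n .{{_ : NonZero n}} (c : Cell d n) →
  n ∣ toℕ (iteratedCyclic d n c) + coordSum c
iteratedCyclic-∣-entry+coordSum d n c
  rewrite toℕ-fromℕ< (m%n<n (n ∸ coordSum c % n) n) =
  n∣m+o⇒n∣m%n+o (n ∸ coordSum c % n) (coordSum c) (n∣[n∸m%n]+m n (coordSum c))

2∤1 : ¬ 2 ∣ 1
2∤1 2∣1 with ∣1⇒≡1 2∣1
... | ()

2∣n⇒2∤1+n : ∀ {n} → 2 ∣ n → ¬ 2 ∣ suc n
2∣n⇒2∤1+n 2∣n 2∣1+n = 2∤1 (∣m+n∣m⇒∣n (subst (2 ∣_) (+-comm 1 _) 2∣1+n) 2∣n)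

2∤m⇒2∤n⇒2∤m*n : ∀ {m n} → ¬ 2 ∣ m → ¬ 2 ∣ n → ¬ 2 ∣ m * n
2∤m⇒2∤n⇒2∤m*n {m} {n} 2∤m 2∤n 2∣m*n with euclidsLemma m n (from-yes (prime? 2)) 2∣m*n
... | inj₁ 2∣m = 2∤m 2∣m
... | inj₂ 2∣n = 2∤n 2∣n

-- For n = 2h, j · triangle n = h · j(2h − 1), and j(2h − 1) is odd.
even∤odd*triangle : ∀ n .{{_ : NonZero n}} {j} → 2 ∣ n → ¬ 2 ∣ j → ¬ n ∣ j * triangle n
even∤odd*triangle n {j} (divides zero    n≡0) 2∤j _ = ≢-nonZero⁻¹ n n≡0
even∤odd*triangle n {j} (divides (suc h) refl) 2∤j n∣jT =
  2∤m⇒2∤n⇒2∤m*n 2∤j (2∣n⇒2∤1+n (divides h refl))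
    (*-cancelˡ-∣ (suc h) (subst (suc h * 2 ∣_) factor n∣jT))
  where
  factor : j * triangle (suc h * 2) ≡ suc h * (j * suc (h * 2))
  factor = begin
    j * triangle (suc h * 2)    ≡⟨ cong (j *_) (triangle-even h) ⟩
    j * (suc h * suc (h * 2))   ≡⟨ reorder j h ⟩
    suc h * (j * suc (h * 2))   ∎
    where
    reorder : ∀ j h → j * (suc h * suc (h * 2)) ≡ suc h * (j * suc (h * 2))
    reorder = solve-∀

proposition1 : (n d k : ℕ) → .{{_ : NonZero n}} → 2 ∣ n → 0 < d → 2 ∣ d → ¬ (2 ∣ k)
    → ¬ Σ (Multiset d n) (λ m → IsMultiplex (iteratedCyclic d n) k m)
proposition1 n d k 2∣n _ 2∣d 2∤k (m , multiplex) =
  even∤odd*triangle n 2∣n (2∤m⇒2∤n⇒2∤m*n (2∣n⇒2∤1+n 2∣d) 2∤k)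
    (subst (n ∣_) (multiplex-sumCells-*-entry+coordSum (iteratedCyclic d n) m multiplex)
      (sumCells-∣ d n _ (λ c → ∣-trans (iteratedCyclic-∣-entry+coordSum d n c) (n∣m*n (m c)))))
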